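{- Let $G=(V,E)$ satisfy the standing assumptions, have highway dimension at most $h$, and let $U$ be its maximum edge weight. Then for every valid hierarchy of $G$, the largest index $i$ such that $C[i]$ is nonempty is $O(\log(|V|+U))$, with the hidden constant depending only on $h$.
   Context: Standing assumptions: $G$ is a finite connected undirected graph, edge weights at least $1$, shortest paths unique ($p(u,w)$, length $d(u,w)$), every edge is the shortest path between its endpoints. $B(v,r)=\{v': d(v,v')\le r\}$; $\mathrm{maxedge}(p)$ is the maximum edge weight on $p$. Highway dimension: an $r$-witness of a shortest path $p$ from $u$ to $w$ is a shortest path $p'$ of length at least $r$ containing $p$, with endpoints $u$ or a neighbor of $u$, and $w$ or a neighbor of $w$; $p$ is $r$-significant if it has one; $d(v,q)$ is the distance from $v$ to the nearest vertex of $q$; $S(v,r)$ is the set of $r$-significant paths with an $r$-witness $p'$ with $d(v,p')\le 2r$; the highway dimension is the least $h$ such that for all $r>0,v$ some $C\subseteq V$, $|C|\le h$, meets every path of $S(v,r)$. Shortcut graph $G(C,r)$: vertex set $C$, edge $\{v_1,v_2\}$ of weight $d(v_1,v_2)$ iff $d(v_1,v_2)\le r$ and $p(v_1,v_2)$ contains no element of $C$ besides $v_1,v_2$. Hierarchy: $E[i]$ ($i\ge -1$) is the set of edges of weight in $(8^{i-1},8^i]$, $E[\ge i]=\bigcup_{j\ge i}E[j]$. $C'[-1]=\emptyset$, $G[-1]$ empty; $C[i]=C'[i]\cup V(E[\ge i])$ for $i\ge -1$; $G[i]=G(C[i],8^i)$ for $i\ge0$. For $i\ge0$ a valid $C'[i]$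 is obtained by: start with $\emptyset$; for each pair $v,v'\in V(G[i-1])$ (arbitrary order) with $d_{G[i-1]}(v,v')\in[\frac34 8^i,8^i]$ and $\mathrm{maxedge}(p_G(v,v'))\le 8^{i-1}$, if $p_{G[i-1]}(v,v')$ has no element of $C'[i]$, add the vertex of $G[i-1]$ on it closest to its midpoint; a valid hierarchy uses a valid $C'[i]$ at each level.
   Formalization: The edge weights of $G$ are rational, so the maximum edge weight $U$ is rational as well. -}

module Defs where


open import Data.Nat as ℕ using (ℕ; zero; suc)
open import Data.Integer using (+_)
open import Data.Fin as Fin using (Fin)
open import Data.Rational using (ℚ; 0ℚ; 1ℚ; ½; _+_; _*_; _-_; _≤_; _<_; ∣_∣; _/_)
open import Data.List using (List; []; _∷_; _++_; length; lookup; take)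
open import Data.List.Membership.Propositional using (_∈_)
open import Data.List.Relation.Unary.Any using (Any)
open import Data.List.Relation.Unary.Unique.Propositional using (Unique)
open import Data.Product using (Σ; ∃; _×_; _,_)
open import Data.Sum using (_⊎_)
open import Data.Empty using (⊥)
open import Relation.Nullary using (¬_)
open import Relation.Binary.PropositionalEquality using (_≡_; _≢_)
open import Function.Bundles using (_⇔_)

infixr 8 _^ℚ_
_^ℚ_ : ℚ → ℕ → ℚ
q ^ℚ zero  = 1ℚ
q ^ℚ suc k = q * (q ^ℚ k)

ℕtoℚ : ℕ → ℚ
ℕtoℚ k = + k / 1

pow8 : ℕ → ℚ
pow8 i = ℕtoℚ 8 ^ℚ i

-- 8^(i-1)  (so  thr 0 = 1/8)
thr : ℕ → ℚ
thr i = pow8 i * (+ 1 / 8)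

module _ {n : ℕ} where

  data IsWalk (R : Fin n → Fin n → Set) : Fin n → Fin n → List (Fin n) → Set where
    single : ∀ {x} → IsWalk R x x (x ∷ [])
    cons   : ∀ {x y z ps} → R x y → IsWalk R y z (y ∷ ps) → IsWalk R x z (x ∷ y ∷ ps)

  wlen : (Fin n → Fin n → ℚ) → List (Fin n) → ℚ
  wlen f []            = 0ℚ
  wlen f (x ∷ [])      = 0ℚ
  wlen f (x ∷ y ∷ ps)  = f x y + wlen f (y ∷ ps)

  data AllSteps (P : Fin n → Fin n → Set) : List (Fin n) → Set where
    []₀ : AllSteps P []
    [-] : ∀ {x} → AllSteps P (x ∷ [])
    _∷ₛ_ : ∀ {x y ps} → P x y → AllSteps P (y ∷ ps) → AllSteps P (x ∷ y ∷ ps)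

-- Graphs satisfying the standing assumptions.
-- Vertices are Fin n; Adj is the (symmetric, irreflexive) edge relation,
-- w the weight of an edge; sp u v is the unique shortest path p(u,v).

record Graph (n : ℕ) : Set₁ where
  field
    Adj        : Fin n → Fin n → Set
    w          : Fin n → Fin n → ℚ
    Adj-sym    : ∀ {u v} → Adj u v → Adj v u
    w-sym      : ∀ {u v} → Adj u v → w u v ≡ w v u
    Adj-irrefl : ∀ {u} → ¬ Adj u u
    w≥1        : ∀ {u v} → Adj u v → 1ℚ ≤ w u v
    -- connected with unique shortest paths
    sp         : Fin n → Fin n → List (Fin n)
    sp-walk    : ∀ u v → IsWalk Adj u v (sp u v)
    sp-min     : ∀ u v q → IsWalk Adj u v q → wlen w (sp u v) ≤ wlen w q
    sp-unique  : ∀ u v q → IsWalk Adj u v q → wlen w q ≤ wlen w (sp u v) → q ≡ sp u v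
    edge-sp    : ∀ {u v} → Adj u v → sp u v ≡ u ∷ v ∷ []

module _ {n : ℕ} (G : Graph n) where
  open Graph G

  dist : Fin n → Fin n → ℚ
  dist u v = wlen w (sp u v)

  IsMaxEdgeWeight : ℚ → Set
  IsMaxEdgeWeight U = (∀ u v → Adj u v → w u v ≤ U) × (Σ (Fin n) λ u → Σ (Fin n) λ v → Adj u v × w u v ≡ U)

  -- p(u,w) lies in S(v,r): it has an r-witness p' = p(a,b) with d(v,p') ≤ 2r
  InS : Fin n → ℚ → Fin n → Fin n → Set
  InS v r u x =
    Σ (Fin n) λ a → Σ (Fin n) λ b →
      (a ≡ u ⊎ Adj a u) × (b ≡ x ⊎ Adj b x) × r ≤ dist a b ×
      (Σ (List (Fin n)) λ xs → Σ (List (Fin n)) λ ys → sp a b ≡ xs ++ sp u x ++ ys) ×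
      (Σ (Fin n) λ y → y ∈ sp a b × dist v y ≤ (ℕtoℚ 2) * r)

  HighwayDimAtMost : ℕ → Set
  HighwayDimAtMost h =
    ∀ (r : ℚ) → 0ℚ < r → ∀ (v : Fin n) →
      Σ (List (Fin n)) λ Cs → length Cs ℕ.≤ h ×
        (∀ u x → InS v r u x → Any (_∈ Cs) (sp u x))

  -- Shortcut graph G(C,r) on vertex set C (a predicate on vertices)

  SCEdge : (Fin n → Set) → ℚ → Fin n → Fin n → Set
  SCEdge C r x y =
    C x × C y × x ≢ y × dist x y ≤ r ×
    (∀ z → z ∈ sp x y → C z → z ≡ x ⊎ z ≡ y)

  ShortestSC : (Fin n → Set) → ℚ → Fin n → Fin n → List (Fin n) → Set
  ShortestSC C r v v' P =
    IsWalk (SCEdge C r) v v' P ×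
    (∀ Q → IsWalk (SCEdge C r) v v' Q → wlen dist P ≤ wlen dist Q)

  -- Hierarchy.  Cp i is C'[i] (i ≥ 0);  C[i] = C'[i] ∪ V(E[≥ i]).

  VEge : ℕ → Fin n → Set
  VEge i x = Σ (Fin n) λ y → Adj x y × thr i < w x y

  Clev : (ℕ → Fin n → Set) → ℕ → Fin n → Set
  Clev Cp i x = Cp i x ⊎ VEge i x

  module AtLevel (Cp : ℕ → Fin n → Set) (i : ℕ) where
    -- construction of C'[i+1] from G[i] = G(C[i], 8^i)
    Ci : Fin n → Set
    Ci = Clev Cp i

    ShortestGi : Fin n → Fin n → List (Fin n) → Set
    ShortestGi = ShortestSC Ci (pow8 i)

    InRange : ℚ → Set
    InRange L = ((+ 3 / 4) * pow8 (suc i) ≤ L) × (L ≤ pow8 (suc i))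

    MaxEdgeOK : Fin n → Fin n → Set
    MaxEdgeOK v v' = AllSteps (λ a b → w a b ≤ pow8 i) (sp v v')

    Qualifies : Fin n → Fin n → Set
    Qualifies v v' = Σ (List (Fin n)) λ P → ShortestGi v v' P × InRange (wlen dist P) × MaxEdgeOK v v'

    -- m is a vertex of P closest to the midpoint of P
    -- (position of the k-th vertex = length of the prefix ending at it)
    ClosestToMid : List (Fin n) → Fin n → Set
    ClosestToMid P m =
      Σ (Fin (length P)) λ k → m ≡ lookup P k ×
        (∀ (k' : Fin (length P)) → ∣ wlen dist (take (suc (Fin.toℕ k)) P) - ½ * wlen dist P ∣
              ≤ ∣ wlen dist (take (suc (Fin.toℕ k')) P) - ½ * wlen dist P ∣)

    data Step (S : Fin n → Set) : Fin n × Fin n → (Fin n → Set) → Set₁ where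
      add  : ∀ {v v'} P m → ShortestGi v v' P → InRange (wlen dist P) → MaxEdgeOK v v' →
             (∀ z → z ∈ P → ¬ S z) → ClosestToMid P m →
             Step S (v , v') (λ x → S x ⊎ x ≡ m)
      hit  : ∀ {v v'} P → ShortestGi v v' P → InRange (wlen dist P) → MaxEdgeOK v v' →
             (Σ (Fin n) λ z → z ∈ P × S z) →
             Step S (v , v') S
      skip : ∀ {v v'} → ¬ Qualifies v v' → Step S (v , v') S

    data Run : (Fin n → Set) → List (Fin n × Fin n) → (Fin n → Set) → Set₁ where
      done : ∀ {S} → Run S [] S
      step : ∀ {S S' S'' pr ps} → Step S pr S' → Run S' ps S'' → Run S (pr ∷ ps) S''

    Enumerates : List (Fin n × Fin n) → Set
    Enumerates ps = Unique ps × (∀ v v' → ((v , v') ∈ ps) ⇔ (Ci v × Ci v' × v Fin.< v'))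

    ValidNext : Set₁
    ValidNext =
      Σ (List (Fin n × Fin n)) λ ps → Enumerates ps ×
        Σ (Fin n → Set) λ S → Run (λ _ → ⊥) ps S × (∀ x → Cp (suc i) x ⇔ S x)

  -- A valid hierarchy, given by the sets C'[i] for i ≥ 0
  -- (C'[0] = ∅ since G[-1] is empty).
  ValidHierarchy : (ℕ → Fin n → Set) → Set₁
  ValidHierarchy Cp = (∀ x → ¬ Cp 0 x) × (∀ i → AtLevel.ValidNext Cp i)

{-# OPTIONS --safe #-}
module Submission where

-- A vertex of C[i] is either an endpoint of an edge heavier than 8^(i-1), so 8^i < 8U, or it
-- was put into C'[i] as the midpoint of a shortest path of G[i-1] of length at least (3/4)8^i.
-- That path may be taken simple, so it has fewer than n edges, each of length d(v,v') ≤ nU;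
-- hence 8^i ≤ (4/3)n²U. Either way 2^i ≤ 8^i ≤ 8n²U ≤ (n+U)^6.

open import Defs
open import Data.Nat using (ℕ)
open import Data.Fin using (Fin)
open import Data.Rational using (ℚ; _+_; _≤_)
open import Data.Product using (Σ; _×_)

open import Data.Nat as ℕ using (zero; suc; pred)
import Data.Nat.Properties as ℕ
import Data.Fin as Fin
open import Data.Fin.Properties using (injective⇒≤)
open import Data.Integer as ℤ using (+_)
import Data.Integer.Properties as ℤP
open import Data.Rational using (0ℚ; 1ℚ; _/_; _*_; _<_; nonNegative)
open import Data.Rational.Properties
open import Data.Nat.Coprimality as Coprimality using (1-coprimeTo)
open import Data.List using (List; _∷_; length; lookup)
open import Data.List.Membership.Propositional using (_∈_)
open import Data.List.Membership.Propositional.Properties using (∈-lookup)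
open import Data.List.Relation.Unary.Any using (here; there)
import Data.List.Relation.Unary.All as All
open import Data.List.Relation.Unary.All.Properties.Core using (¬Any⇒All¬)
open import Data.List.Relation.Unary.AllPairs using ([]; _∷_)
open import Data.List.Relation.Unary.Unique.Propositional using (Unique)
open import Data.List.Relation.Unary.Unique.Propositional.Properties using (Unique[x∷xs]⇒x∉xs)
open import Data.Product using (∃; ∃₂; _,_; proj₁)
open import Data.Sum using (_⊎_; inj₁; inj₂)
open import Data.Empty using (⊥-elim)
open import Relation.Nullary using (yes; no)
open import Relation.Nullary.Decidable using (toWitness)
open import Relation.Binary.PropositionalEquality
open import Function.Bundles using (Equivalence)

ℕtoℚ-suc : ∀ k → ℕtoℚ (suc k) ≡ 1ℚ + ℕtoℚ k
ℕtoℚ-suc k rewrite normalize-coprime (Coprimality.sym (1-coprimeTo k)) =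
  /-cong (cong (λ z → + 1 ℤ.+ z) (sym (ℤP.*-identityʳ (+ k)))) refl

ℕtoℚ-suc-* : ∀ k p → ℕtoℚ (suc k) * p ≡ p + ℕtoℚ k * p
ℕtoℚ-suc-* k p = begin
  ℕtoℚ (suc k) * p     ≡⟨ cong (_* p) (ℕtoℚ-suc k) ⟩
  (1ℚ + ℕtoℚ k) * p    ≡⟨ *-distribʳ-+ p 1ℚ (ℕtoℚ k) ⟩
  1ℚ * p + ℕtoℚ k * p  ≡⟨ cong (_+ ℕtoℚ k * p) (*-identityˡ p) ⟩
  p + ℕtoℚ k * p       ∎
  where open ≡-Reasoning

ℕtoℚ-nonNeg : ∀ k → 0ℚ ≤ ℕtoℚ k
ℕtoℚ-nonNeg k = nonNegative⁻¹ (ℕtoℚ k) {{normalize-nonNeg k 1}}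

ℕtoℚ-mono-≤ : ∀ {k m} → k ℕ.≤ m → ℕtoℚ k ≤ ℕtoℚ m
ℕtoℚ-mono-≤ {m = m} ℕ.z≤n = ℕtoℚ-nonNeg m
ℕtoℚ-mono-≤ {suc k} {suc m} (ℕ.s≤s k≤m)
  rewrite ℕtoℚ-suc k | ℕtoℚ-suc m = +-monoʳ-≤ 1ℚ (ℕtoℚ-mono-≤ k≤m)

*-mono-≤-nonNeg : ∀ {p q r s} → p ≤ q → r ≤ s → 0ℚ ≤ p → 0ℚ ≤ r → p * r ≤ q * s
*-mono-≤-nonNeg {p} {q} {r} {s} p≤q r≤s 0≤p 0≤r = ≤-trans
  (*-monoʳ-≤-nonNeg r {{nonNegative 0≤r}} p≤q)
  (*-monoˡ-≤-nonNeg q {{nonNegative (≤-trans 0≤p p≤q)}} r≤s)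

*-nonNeg : ∀ {p q} → 0ℚ ≤ p → 0ℚ ≤ q → 0ℚ ≤ p * q
*-nonNeg {p} {q} 0≤p 0≤q =
  nonNegative⁻¹ (p * q) {{nonNeg*nonNeg⇒nonNeg p {{nonNegative 0≤p}} q {{nonNegative 0≤q}}}}

^ℚ-distribˡ-+-* : ∀ p k m → p ^ℚ (k ℕ.+ m) ≡ p ^ℚ k * p ^ℚ m
^ℚ-distribˡ-+-* p zero    m = sym (*-identityˡ (p ^ℚ m))
^ℚ-distribˡ-+-* p (suc k) m = trans (cong (p *_) (^ℚ-distribˡ-+-* p k m)) (sym (*-assoc p _ _))

^ℚ-nonNeg : ∀ {p} → 0ℚ ≤ p → ∀ k → 0ℚ ≤ p ^ℚ k
^ℚ-nonNeg 0≤p zero    = nonNegative⁻¹ 1ℚ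
^ℚ-nonNeg 0≤p (suc k) = *-nonNeg 0≤p (^ℚ-nonNeg 0≤p k)

^ℚ-monoˡ-≤ : ∀ {p q} → 0ℚ ≤ p → p ≤ q → ∀ k → p ^ℚ k ≤ q ^ℚ k
^ℚ-monoˡ-≤ 0≤p p≤q zero    = ≤-refl
^ℚ-monoˡ-≤ 0≤p p≤q (suc k) = *-mono-≤-nonNeg p≤q (^ℚ-monoˡ-≤ 0≤p p≤q k) 0≤p (^ℚ-nonNeg 0≤p k)

Unique-lookup-injective : ∀ {a} {A : Set a} {xs : List A} → Unique xs →
                          ∀ {i j} → lookup xs i ≡ lookup xs j → i ≡ j
Unique-lookup-injective {xs = _ ∷ _} u       {Fin.zero}  {Fin.zero}  _  = refl
Unique-lookup-injective {xs = _ ∷ _} u       {Fin.zero}  {Fin.suc j} eq =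
  ⊥-elim (Unique[x∷xs]⇒x∉xs u (subst (_∈ _) (sym eq) (∈-lookup j)))
Unique-lookup-injective {xs = _ ∷ _} u       {Fin.suc i} {Fin.zero}  eq =
  ⊥-elim (Unique[x∷xs]⇒x∉xs u (subst (_∈ _) eq (∈-lookup i)))
Unique-lookup-injective {xs = _ ∷ _} (_ ∷ u) {Fin.suc i} {Fin.suc j} eq =
  cong Fin.suc (Unique-lookup-injective u eq)

length-Unique≤ : ∀ {n} {xs : List (Fin n)} → Unique xs → length xs ℕ.≤ n
length-Unique≤ u = injective⇒≤ (Unique-lookup-injective u)

module _ {n : ℕ} {R : Fin n → Fin n → Set} where
  open import Data.List.Membership.DecPropositional (Fin._≟_ {n}) using (_∈?_)

  IsWalk-prepend : ∀ {x y z L} → R x y → IsWalk R y z L → IsWalk R x z (x ∷ L)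
  IsWalk-prepend r single      = cons r single
  IsWalk-prepend r (cons r′ w) = cons r (cons r′ w)

  IsWalk-suffix : ∀ {x y z L} → IsWalk R y z L → Unique L → x ∈ L →
                  ∃ λ L′ → IsWalk R x z L′ × Unique L′
  IsWalk-suffix single      u       (here refl)  = _ , single , u
  IsWalk-suffix (cons r w)  u       (here refl)  = _ , cons r w , u
  IsWalk-suffix (cons _ w)  (_ ∷ u) (there x∈L) = IsWalk-suffix w u x∈L

  IsWalk⇒uniqueWalk : ∀ {a b L} → IsWalk R a b L → ∃ λ L′ → IsWalk R a b L′ × Unique L′
  IsWalk⇒uniqueWalk single = _ , single , All.[] ∷ []
  IsWalk⇒uniqueWalk (cons {x} r w) with IsWalk⇒uniqueWalk w
  ... | L′ , w′ , u′ with x ∈? L′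
  ...   | yes x∈L′ = IsWalk-suffix w′ u′ x∈L′
  ...   | no  x∉L′ = x ∷ L′ , IsWalk-prepend r w′ , ¬Any⇒All¬ L′ x∉L′ ∷ u′

  wlen-IsWalk≤ : ∀ (f : Fin n → Fin n → ℚ) {M} → (∀ {x y} → R x y → f x y ≤ M) →
                 ∀ {a b L} → IsWalk R a b L → wlen f L ≤ ℕtoℚ (pred (length L)) * M
  wlen-IsWalk≤ f {M} f≤M single = ≤-reflexive (sym (*-zeroˡ M))
  wlen-IsWalk≤ f {M} f≤M (cons {ps = ps} r w) =
    subst (_ ≤_) (sym (ℕtoℚ-suc-* (length ps) M)) (+-mono-≤ (f≤M r) (wlen-IsWalk≤ f f≤M w))

  IsWalk⇒shortWalk : ∀ (f : Fin n → Fin n → ℚ) {M} → 0ℚ ≤ M → (∀ {x y} → R x y → f x y ≤ M) →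
                     ∀ {a b L} → IsWalk R a b L → ∃ λ L′ → IsWalk R a b L′ × wlen f L′ ≤ ℕtoℚ n * M
  IsWalk⇒shortWalk f {M} 0≤M f≤M w with IsWalk⇒uniqueWalk w
  ... | L′ , w′ , u′ = L′ , w′ , ≤-trans (wlen-IsWalk≤ f f≤M w′)
    (*-monoʳ-≤-nonNeg M {{nonNegative 0≤M}} (ℕtoℚ-mono-≤ (ℕ.≤-trans ℕ.pred[n]≤n (length-Unique≤ u′))))

module _ {n : ℕ} (G : Graph n) {U : ℚ} (0≤U : 0ℚ ≤ U)
         (w≤U : ∀ u v → Graph.Adj G u v → Graph.w G u v ≤ U) where
  open Graph G

  dist≤ : ∀ x y → dist G x y ≤ ℕtoℚ n * U
  dist≤ x y with IsWalk⇒shortWalk w 0≤U (λ {u} {v} → w≤U u v) (sp-walk x y)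
  ... | L , walk , L≤ = ≤-trans (sp-min x y L walk) L≤

  ShortestSC-wlen≤ : ∀ {C r v v′ P} → ShortestSC G C r v v′ P → wlen (dist G) P ≤ ℕtoℚ n * (ℕtoℚ n * U)
  ShortestSC-wlen≤ (walk , minimal)
    with IsWalk⇒shortWalk (dist G) (*-nonNeg (ℕtoℚ-nonNeg n) 0≤U) (λ {x} {y} _ → dist≤ x y) walk
  ... | Q , walkQ , Q≤ = ≤-trans (minimal Q walkQ) Q≤

module _ {n : ℕ} (G : Graph n) (Cp : ℕ → Fin n → Set) (i : ℕ) where
  open AtLevel G Cp i

  LongShortcutPath : Set
  LongShortcutPath = ∃₂ λ v v′ → ∃ λ P → ShortestGi v v′ P × InRange (wlen (dist G) P)

  Step-new⇒long : ∀ {S pr S′ x} → Step S pr S′ → S′ x → S x ⊎ LongShortcutPath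
  Step-new⇒long (add _ _ _ _ _ _ _)               (inj₁ x∈S) = inj₁ x∈S
  Step-new⇒long (add {v} {v′} P _ sp range _ _ _) (inj₂ _)   = inj₂ (v , v′ , P , sp , range)
  Step-new⇒long (hit _ _ _ _ _)                   x∈S        = inj₁ x∈S
  Step-new⇒long (skip _)                          x∈S        = inj₁ x∈S

  Run-new⇒long : ∀ {S ps S′ x} → Run S ps S′ → S′ x → S x ⊎ LongShortcutPath
  Run-new⇒long done          x∈S  = inj₁ x∈S
  Run-new⇒long (step st run) x∈S′ with Run-new⇒long run x∈S′
  ... | inj₁ x∈S″ = Step-new⇒long st x∈S″
  ... | inj₂ long = inj₂ long

C′-suc⇒LongShortcutPath : ∀ {n} (G : Graph n) {Cp} → ValidHierarchy G Cp →
                          ∀ i {x} → Cp (suc i) x → LongShortcutPath G Cp i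
C′-suc⇒LongShortcutPath G {Cp} (_ , next) i x∈C′ with next i
... | _ , _ , _ , run , C′⇔S with Run-new⇒long G Cp i run (Equivalence.to (C′⇔S _) x∈C′)
...   | inj₁ ()
...   | inj₂ long = long

module _ {p q : ℚ} where
  *⅛<⇒≤8* : p * (+ 1 / 8) < q → p ≤ ℕtoℚ 8 * q
  *⅛<⇒≤8* p/8<q = begin
    p                         ≡⟨ sym (*-identityʳ p) ⟩
    p * ((+ 1 / 8) * ℕtoℚ 8)  ≡⟨ sym (*-assoc p (+ 1 / 8) (ℕtoℚ 8)) ⟩
    p * (+ 1 / 8) * ℕtoℚ 8    ≡⟨ *-comm (p * (+ 1 / 8)) (ℕtoℚ 8) ⟩
    ℕtoℚ 8 * (p * (+ 1 / 8))  ≤⟨ *-monoˡ-≤-nonNeg (ℕtoℚ 8) (<⇒≤ p/8<q) ⟩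
    ℕtoℚ 8 * q                ∎
    where open ≤-Reasoning

  ¾*≤⇒≤8* : 0ℚ ≤ q → (+ 3 / 4) * p ≤ q → p ≤ ℕtoℚ 8 * q
  ¾*≤⇒≤8* 0≤q ¾p≤q = begin
    p                            ≡⟨ sym (*-identityˡ p) ⟩
    ((+ 4 / 3) * (+ 3 / 4)) * p  ≡⟨ *-assoc (+ 4 / 3) (+ 3 / 4) p ⟩
    (+ 4 / 3) * ((+ 3 / 4) * p)  ≤⟨ *-monoˡ-≤-nonNeg (+ 4 / 3) ¾p≤q ⟩
    (+ 4 / 3) * q                ≤⟨ *-monoʳ-≤-nonNeg q {{nonNegative 0≤q}} (toWitness {a? = + 4 / 3 ≤? ℕtoℚ 8} _) ⟩
    ℕtoℚ 8 * q                   ∎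
    where open ≤-Reasoning

  1≤p⇒q≤p*[p*q] : 1ℚ ≤ p → 0ℚ ≤ q → q ≤ p * (p * q)
  1≤p⇒q≤p*[p*q] 1≤p 0≤q = begin
    q               ≡⟨ sym (trans (*-identityˡ (1ℚ * q)) (*-identityˡ q)) ⟩
    1ℚ * (1ℚ * q)   ≤⟨ *-mono-≤-nonNeg 1≤p (*-mono-≤-nonNeg 1≤p ≤-refl 0≤1 0≤q) 0≤1 (*-nonNeg 0≤1 0≤q) ⟩
    p * (p * q)     ∎
    where
    open ≤-Reasoning
    0≤1 : 0ℚ ≤ 1ℚ
    0≤1 = nonNegative⁻¹ 1ℚ

  8*[p*[p*q]]≤[p+q]^6 : 1ℚ ≤ p → 1ℚ ≤ q → ℕtoℚ 8 * (p * (p * q)) ≤ (p + q) ^ℚ 6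
  8*[p*[p*q]]≤[p+q]^6 1≤p 1≤q = begin
    ℕtoℚ 8 * (p * (p * q))  ≤⟨ *-mono-≤-nonNeg 8≤s³ pq≤s³ (ℕtoℚ-nonNeg 8) (*-nonNeg 0≤p (*-nonNeg 0≤p 0≤q)) ⟩
    s ^ℚ 3 * s ^ℚ 3         ≡⟨ sym (^ℚ-distribˡ-+-* s 3 3) ⟩
    s ^ℚ 6                  ∎
    where
    open ≤-Reasoning
    s = p + q
    0≤p = ≤-trans (nonNegative⁻¹ 1ℚ) 1≤p
    0≤q = ≤-trans (nonNegative⁻¹ 1ℚ) 1≤q
    p≤s : p ≤ s
    p≤s = subst (_≤ s) (+-identityʳ p) (+-monoʳ-≤ p 0≤q)
    q≤s : q ≤ s
    q≤s = subst (_≤ s) (+-identityˡ q) (+-monoˡ-≤ q 0≤p)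
    8≤s³ : ℕtoℚ 2 ^ℚ 3 ≤ s ^ℚ 3
    8≤s³ = ^ℚ-monoˡ-≤ (ℕtoℚ-nonNeg 2) (+-mono-≤ 1≤p 1≤q) 3
    pq≤s³ : p * (p * q) ≤ s ^ℚ 3
    pq≤s³ = *-mono-≤-nonNeg p≤s (*-mono-≤-nonNeg p≤s (subst (q ≤_) (sym (*-identityʳ s)) q≤s) 0≤p 0≤q)
              0≤p (*-nonNeg 0≤p 0≤q)

1≤ℕtoℚ : ∀ {n} → Fin n → 1ℚ ≤ ℕtoℚ n
1≤ℕtoℚ {suc m} _ = ℕtoℚ-mono-≤ {1} {suc m} (ℕ.s≤s ℕ.z≤n)

IsMaxEdgeWeight⇒1≤ : ∀ {n} (G : Graph n) {U} → IsMaxEdgeWeight G U → 1ℚ ≤ U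
IsMaxEdgeWeight⇒1≤ G (_ , _ , _ , uv , wuv≡U) = subst (1ℚ ≤_) wuv≡U (Graph.w≥1 G uv)

module _ {n : ℕ} (G : Graph n) {U : ℚ} (maxU : IsMaxEdgeWeight G U)
         {Cp : ℕ → Fin n → Set} (hier : ValidHierarchy G Cp) where
  private
    N = ℕtoℚ n
    0≤U = ≤-trans (nonNegative⁻¹ 1ℚ) (IsMaxEdgeWeight⇒1≤ G maxU)
    0≤N*[N*U] = *-nonNeg (ℕtoℚ-nonNeg n) (*-nonNeg (ℕtoℚ-nonNeg n) 0≤U)

  Clev⇒pow8≤ : ∀ i {x} → Clev G Cp i x → pow8 i ≤ ℕtoℚ 8 * (N * (N * U))
  Clev⇒pow8≤ i {x} (inj₂ (y , xy , thr<w)) = begin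
    pow8 i                  ≤⟨ *⅛<⇒≤8* (<-≤-trans thr<w (proj₁ maxU x y xy)) ⟩
    ℕtoℚ 8 * U              ≤⟨ *-monoˡ-≤-nonNeg (ℕtoℚ 8) (1≤p⇒q≤p*[p*q] (1≤ℕtoℚ x) 0≤U) ⟩
    ℕtoℚ 8 * (N * (N * U))  ∎
    where open ≤-Reasoning
  Clev⇒pow8≤ zero    (inj₁ x∈C′) = ⊥-elim (proj₁ hier _ x∈C′)
  Clev⇒pow8≤ (suc i) (inj₁ x∈C′) with C′-suc⇒LongShortcutPath G hier i x∈C′
  ... | _ , _ , _ , shortest , ¾8^i≤P , _ =
    ¾*≤⇒≤8* 0≤N*[N*U] (≤-trans ¾8^i≤P (ShortestSC-wlen≤ G 0≤U (proj₁ maxU) shortest))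

mainTheorem14 : ∀ (h : ℕ) → Σ ℕ λ c →
    ∀ (n : ℕ) (G : Graph n) (U : ℚ) → IsMaxEdgeWeight G U → HighwayDimAtMost G h →
    ∀ (Cp : ℕ → Fin n → Set) → ValidHierarchy G Cp →
    ∀ (i : ℕ) (x : Fin n) → Clev G Cp i x →
    ℕtoℚ 2 ^ℚ i ≤ (ℕtoℚ n + U) ^ℚ c
mainTheorem14 _ = 6 , λ n G U maxU _ Cp hier i x x∈C → begin
  ℕtoℚ 2 ^ℚ i                            ≤⟨ ^ℚ-monoˡ-≤ (ℕtoℚ-nonNeg 2) 2≤8 i ⟩
  pow8 i                                 ≤⟨ Clev⇒pow8≤ G maxU hier i x∈C ⟩
  ℕtoℚ 8 * (ℕtoℚ n * (ℕtoℚ n * U))       ≤⟨ 8*[p*[p*q]]≤[p+q]^6 (1≤ℕtoℚ x) (IsMaxEdgeWeight⇒1≤ G maxU) ⟩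
  (ℕtoℚ n + U) ^ℚ 6                      ∎
  where
  open ≤-Reasoning
  2≤8 : ℕtoℚ 2 ≤ ℕtoℚ 8
  2≤8 = ℕtoℚ-mono-≤ {2} {8} (ℕ.s≤s (ℕ.s≤s ℕ.z≤n))
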